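{- Let $a,b\in\mathbb{Z}$, $q\in\mathbb{Z}\setminus\{0\}$, and $w_r=w_r(a,b,q)$ given by $w_0=a$, $w_1=b$, $w_r=qw_{r-1}+w_{r-2}$. Let $p$ be an odd prime with $p\mid(q^2+4)$, let $m$ be a positive integer with $\gcd(p,m)=1$, and suppose $\gcd(a^2+qab-b^2,p)=1$. Suppose that $k(pm)=pk(m)$ and that $(w_r)$ modulo $m$ is residue complete. Then $(w_r)$ modulo $pm$ is residue complete.
   Context: For a positive integer $n$, $k(n)$ denotes the order of $\sigma=\begin{pmatrix} q&1\\ 1&0\end{pmatrix}$ modulo $n$, i.e. the smallest positive integer $k$ with $\sigma^k\equiv I\pmod n$. A sequence is residue complete modulo $n$ if every residue class of $\mathbb{Z}_n$ occurs among its terms modulo $n$. -}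

module Defs where

open import Data.Nat using (ℕ; zero; suc; _<_)
open import Data.Integer using (ℤ; _+_; _-_; _*_; +_; 0ℤ; 1ℤ)
open import Data.Integer.Divisibility using (_∣_)
open import Data.Product using (Σ; _×_; _,_)

w : ℤ → ℤ → ℤ → ℕ → ℤ
w a b q zero = a
w a b q (suc zero) = b
w a b q (suc (suc r)) = q * w a b q (suc r) + w a b q r

record Mat2 : Set where
  constructor mat
  field
    m11 m12 m21 m22 : ℤ

open Mat2 public

_⊗_ : Mat2 → Mat2 → Mat2
mat a b c d ⊗ mat e f g h = mat (a * e + b * g) (a * f + b * h) (c * e + d * g) (c * f + d * h)

I₂ : Mat2
I₂ = mat 1ℤ 0ℤ 0ℤ 1ℤ

σ : ℤ → Mat2
σ q = mat q 1ℤ 1ℤ 0ℤ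

infixr 8 _^ᴹ_
infix 4 _≡ᴹ_[mod_] _≡_[mod_]
_^ᴹ_ : Mat2 → ℕ → Mat2
A ^ᴹ zero = I₂
A ^ᴹ suc k = A ⊗ (A ^ᴹ k)

_≡_[mod_] : ℤ → ℤ → ℕ → Set
x ≡ y [mod n ] = (+ n) ∣ (x - y)

_≡ᴹ_[mod_] : Mat2 → Mat2 → ℕ → Set
A ≡ᴹ B [mod n ] =
  (m11 A ≡ m11 B [mod n ]) × (m12 A ≡ m12 B [mod n ]) ×
  (m21 A ≡ m21 B [mod n ]) × (m22 A ≡ m22 B [mod n ])

-- IsOrder q n k : k = k(n), the least positive k with σ^k ≡ I (mod n)
IsOrder : ℤ → ℕ → ℕ → Set
IsOrder q n k =
  (0 < k) × (σ q ^ᴹ k ≡ᴹ I₂ [mod n ]) ×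
  (∀ j → 0 < j → σ q ^ᴹ j ≡ᴹ I₂ [mod n ] → k Data.Nat.≤ j)

ResidueComplete : (ℕ → ℤ) → ℕ → Set
ResidueComplete s n = ∀ (x : ℤ) → Σ ℕ (λ r → s r ≡ x [mod n ])

-- Modulo p, with p = 2 u + 1 and t = q (u + 1), we have q ≡ 2 t and t² ≡ -1, so the
-- characteristic polynomial x² - q x - 1 of σ is (x - t)² and
-- t w_r ≡ t^r (t a + r (b - t a)).  Let k = k(m).  Since k(pm) = p k, σ^(pk) ≡ I but
-- σ^k ≢ I modulo p: the first forces t^k ≡ 1 (as t^(pk) ≡ 1, t⁴ ≡ 1 and p is odd), and
-- then the second forces p ∤ k.  Hence t w_(r+kj) ≡ t w_r + j k t^r (b - t a) modulo p,
-- where b - t a is a unit because a² + q a b - b² ≡ -(b - t a)².  Starting from r with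
-- w_r ≡ x (mod m), which persists along r + k j, a suitable j also gives w ≡ x (mod p).

module Submission where

open import Defs
open import Data.Nat using (ℕ; zero; suc; _<_; _∸_; s≤s; NonZero)
import Data.Nat as ℕ
import Data.Nat.Properties as ℕP
import Data.Nat.Tactic.RingSolver as ℕSolver
import Data.Nat.Divisibility as ND
open import Data.Nat.DivMod using (_%_; _/_; m%n<n; m≡m%n+[m/n]*n)
open import Data.Nat.GCD using (gcd; module Bézout)
open import Data.Nat.LCM using (lcm; lcm-least; gcd*lcm)
open import Data.Nat.Coprimality as Cop using (Coprime; coprime-Bézout; gcd≡1⇒coprime)
open import Data.Nat.Primality using (Prime; prime⇒irreducible; prime⇒nonTrivial; prime⇒nonZero)
open import Data.Integer using (ℤ; +_; _+_; _-_; _*_; -_; _^_; ∣_∣; 0ℤ; 1ℤ)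
import Data.Integer.Properties as ℤP
open import Data.Integer.Divisibility using (_∣_)
open import Data.Integer.Divisibility.Signed as Signed using (divides) renaming (_∣_ to _∣ₛ_)
open import Data.Integer.DivMod using (_%ℕ_; _/ℕ_; a≡a%ℕn+[a/ℕn]*n; n%ℕd<d)
open import Data.Integer.Tactic.RingSolver using (solve-∀; solve)
open import Data.Fin using (Fin; toℕ; fromℕ<; combine)
import Data.Fin.Properties as FP
open import Data.List using ([]; _∷_)
open import Data.Product using (∃; _×_; _,_; proj₁; proj₂)
open import Data.Sum using (_⊎_; inj₁; inj₂; [_,_]′)
open import Function.Bundles using (_⇔_; mk⇔; Equivalence)
open import Level using (0ℓ)
open import Relation.Binary.Bundles using (Setoid)
open import Relation.Binary.PropositionalEquality as ≡ using (_≡_; _≢_; subst; cong)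
import Relation.Binary.Reasoning.Setoid as SetoidReasoning
open import Relation.Nullary using (¬_; Dec; yes; no; contradiction)
open import Relation.Nullary.Decidable using (_×-dec_)
open import Relation.Unary using (Decidable)

private variable
  n : ℕ
  c d x y z x′ y′ : ℤ

-- Congruence modulo n as a record, so that Agda can infer x and y from it; the
-- relation of Defs is a function of ∣ x - y ∣ and blocks unification.
record _≋_[mod_] (x y : ℤ) (n : ℕ) : Set where
  constructor mod
  field unmod : x ≡ y [mod n ]

open _≋_[mod_] public

infix 4 _≋_[mod_]

∣⇒≋ : ∀ {d} → x - y ≡ d → (+ n) ∣ₛ d → x ≋ y [mod n ]
∣⇒≋ {n = n} eq n∣d = mod (Signed.∣⇒∣ᵤ (subst ((+ n) ∣ₛ_) (≡.sym eq) n∣d))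

≋⇒∣ : x ≋ y [mod n ] → (+ n) ∣ₛ (x - y)
≋⇒∣ x≋y = Signed.∣ᵤ⇒∣ (unmod x≋y)

mod-refl : x ≋ x [mod n ]
mod-refl {x = x} = ∣⇒≋ (ℤP.+-inverseʳ x) (divides 0ℤ ≡.refl)

mod-reflexive : x ≡ y → x ≋ y [mod n ]
mod-reflexive ≡.refl = mod-refl

mod-sym : x ≋ y [mod n ] → y ≋ x [mod n ]
mod-sym {x = x} {y = y} x≋y = ∣⇒≋ (flip x y) (Signed.∣m⇒∣-m (≋⇒∣ x≋y))
  where
  flip : ∀ x y → y - x ≡ - (x - y)
  flip = solve-∀

mod-trans : x ≋ y [mod n ] → y ≋ z [mod n ] → x ≋ z [mod n ]
mod-trans {x = x} {y = y} {z = z} x≋y y≋z = ∣⇒≋ (split x y z) (Signed.∣m∣n⇒∣m+n (≋⇒∣ x≋y) (≋⇒∣ y≋z))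
  where
  split : ∀ x y z → x - z ≡ (x - y) + (y - z)
  split = solve-∀

mod-setoid : ℕ → Setoid 0ℓ 0ℓ
mod-setoid n = record
  { Carrier = ℤ
  ; _≈_ = _≋_[mod n ]
  ; isEquivalence = record { refl = mod-refl ; sym = mod-sym ; trans = mod-trans }
  }

module ModReasoning (n : ℕ) = SetoidReasoning (mod-setoid n)

+-mod-cong : x ≋ y [mod n ] → x′ ≋ y′ [mod n ] → x + x′ ≋ y + y′ [mod n ]
+-mod-cong {x = x} {y = y} {x′ = x′} {y′ = y′} x≋y x′≋y′ =
  ∣⇒≋ (regroup x y x′ y′) (Signed.∣m∣n⇒∣m+n (≋⇒∣ x≋y) (≋⇒∣ x′≋y′))
  where
  regroup : ∀ x y x′ y′ → (x + x′) - (y + y′) ≡ (x - y) + (x′ - y′)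
  regroup = solve-∀

+-mod-congˡ : ∀ z → x ≋ y [mod n ] → z + x ≋ z + y [mod n ]
+-mod-congˡ z = +-mod-cong (mod-refl {x = z})

+-mod-congʳ : ∀ z → x ≋ y [mod n ] → x + z ≋ y + z [mod n ]
+-mod-congʳ z x≋y = +-mod-cong x≋y (mod-refl {x = z})

*-mod-cong : x ≋ y [mod n ] → x′ ≋ y′ [mod n ] → x * x′ ≋ y * y′ [mod n ]
*-mod-cong {x = x} {y = y} {x′ = x′} {y′ = y′} x≋y x′≋y′ =
  ∣⇒≋ (regroup x y x′ y′)
    (Signed.∣m∣n⇒∣m+n (Signed.∣m⇒∣m*n x′ (≋⇒∣ x≋y)) (Signed.∣n⇒∣m*n y (≋⇒∣ x′≋y′)))
  where
  regroup : ∀ x y x′ y′ → x * x′ - y * y′ ≡ (x - y) * x′ + y * (x′ - y′)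
  regroup = solve-∀

*-mod-congˡ : ∀ z → x ≋ y [mod n ] → z * x ≋ z * y [mod n ]
*-mod-congˡ z = *-mod-cong (mod-refl {x = z})

*-mod-congʳ : ∀ z → x ≋ y [mod n ] → x * z ≋ y * z [mod n ]
*-mod-congʳ z x≋y = *-mod-cong x≋y (mod-refl {x = z})

-‿mod-cong : x ≋ y [mod n ] → - x ≋ - y [mod n ]
-‿mod-cong {x = x} {y = y} x≋y = ∣⇒≋ (negate x y) (Signed.∣m⇒∣-m (≋⇒∣ x≋y))
  where
  negate : ∀ x y → - x - - y ≡ - (x - y)
  negate = solve-∀

^-mod-cong : ∀ k → x ≋ y [mod n ] → x ^ k ≋ y ^ k [mod n ]
^-mod-cong zero    x≋y = mod-refl
^-mod-cong (suc k) x≋y = *-mod-cong x≋y (^-mod-cong k x≋y)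

x≋1⇒x^k≋1 : ∀ k → x ≋ 1ℤ [mod n ] → x ^ k ≋ 1ℤ [mod n ]
x≋1⇒x^k≋1 k x≋1 = mod-trans (^-mod-cong k x≋1) (mod-reflexive (ℤP.^-zeroˡ k))

[x+y*n]≋x : ∀ x y → x + y * + n ≋ x [mod n ]
[x+y*n]≋x x y = ∣⇒≋ (cancel x y _) (divides y ≡.refl)
  where
  cancel : ∀ x y n → (x + y * n) - x ≡ y * n
  cancel = solve-∀

[a+m*n]≡b⇒b≋a : ∀ {a b m} → a ℕ.+ m ℕ.* n ≡ b → + b ≋ + a [mod n ]
[a+m*n]≡b⇒b≋a {n = n} {a} {m = m} ≡.refl =
  subst (_≋ + a [mod n ]) (≡.sym (≡.trans (ℤP.pos-+ a (m ℕ.* n)) (cong (λ z → + a + z) (ℤP.pos-* m n))))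
    ([x+y*n]≋x (+ a) (+ m))

[x%ℕn]≋x : ∀ x .{{_ : NonZero n}} → + (x %ℕ n) ≋ x [mod n ]
[x%ℕn]≋x {n = n} x = begin
  + (x %ℕ n)                       ≈⟨ [x+y*n]≋x (+ (x %ℕ n)) (x /ℕ n) ⟨
  + (x %ℕ n) + (x /ℕ n) * + n      ≡⟨ a≡a%ℕn+[a/ℕn]*n x n ⟨
  x                                ∎
  where open ModReasoning n

Unit : ℕ → ℤ → Set
Unit n c = ∃ λ v → v * c ≋ 1ℤ [mod n ]

unit-cancelˡ : Unit n c → c * x ≋ c * y [mod n ] → x ≋ y [mod n ]
unit-cancelˡ {n = n} {c = c} {x = x} {y = y} (v , vc≋1) cx≋cy = begin
  x            ≡⟨ ℤP.*-identityˡ x ⟨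
  1ℤ * x       ≈⟨ *-mod-congʳ x vc≋1 ⟨
  v * c * x    ≡⟨ ℤP.*-assoc v c x ⟩
  v * (c * x)  ≈⟨ *-mod-congˡ v cx≋cy ⟩
  v * (c * y)  ≡⟨ ℤP.*-assoc v c y ⟨
  v * c * y    ≈⟨ *-mod-congʳ y vc≋1 ⟩
  1ℤ * y       ≡⟨ ℤP.*-identityˡ y ⟩
  y            ∎
  where open ModReasoning n

unit-resp : x ≋ y [mod n ] → Unit n x → Unit n y
unit-resp x≋y (v , vx≋1) = v , mod-trans (*-mod-congˡ v (mod-sym x≋y)) vx≋1

unit-* : Unit n c → Unit n d → Unit n (c * d)
unit-* {n = n} {c = c} {d = d} (v , vc≋1) (u , ud≋1) = v * u , (begin
  v * u * (c * d)     ≡⟨ interchange v u c d ⟩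
  (v * c) * (u * d)   ≈⟨ *-mod-cong vc≋1 ud≋1 ⟩
  1ℤ                  ∎)
  where
  open ModReasoning n
  interchange : ∀ v u c d → v * u * (c * d) ≡ (v * c) * (u * d)
  interchange = solve-∀

unit-^ : Unit n c → ∀ k → Unit n (c ^ k)
unit-^ unit-c zero    = 1ℤ , mod-refl
unit-^ unit-c (suc k) = unit-* unit-c (unit-^ unit-c k)

unit-factorʳ : Unit n (c * d) → Unit n d
unit-factorʳ {c = c} {d = d} (v , vcd≋1) = v * c , subst (_≋ 1ℤ [mod _ ]) (≡.sym (ℤP.*-assoc v c d)) vcd≋1

coprime⇒unit-pos : ∀ {c} → Coprime n c → Unit n (+ c)
coprime⇒unit-pos {n = n} {c} coprime with coprime-Bézout coprime
... | Bézout.+- x y eq = - + y , (begin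
  - + y * + c                 ≡⟨ rearrange (+ y) (+ c) ⟩
  1ℤ - (1ℤ + + y * + c)       ≡⟨ cong (λ z → 1ℤ - (1ℤ + z)) (ℤP.pos-* y c) ⟨
  1ℤ - + (1 ℕ.+ y ℕ.* c)      ≈⟨ +-mod-congˡ 1ℤ (-‿mod-cong ([a+m*n]≡b⇒b≋a {a = 0} {m = x} (≡.sym eq))) ⟩
  1ℤ                          ∎)
  where
  open ModReasoning n
  rearrange : ∀ y c → - y * c ≡ 1ℤ - (1ℤ + y * c)
  rearrange = solve-∀
... | Bézout.-+ x y eq = + y , subst (_≋ 1ℤ [mod n ]) (ℤP.pos-* y c) ([a+m*n]≡b⇒b≋a {m = x} eq)

unit-neg : Unit n (- c) → Unit n c
unit-neg {n = n} {c = c} (v , v[-c]≋1) = - v , subst (_≋ 1ℤ [mod n ]) v[-c]≡[-v]c v[-c]≋1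
  where
  v[-c]≡[-v]c : v * - c ≡ - v * c
  v[-c]≡[-v]c = ≡.trans (≡.sym (ℤP.neg-distribʳ-* v c)) (ℤP.neg-distribˡ-* v c)

coprime⇒unit : Coprime n ∣ c ∣ → Unit n c
coprime⇒unit {c = c} coprime with ℤP.+∣i∣≡i⊎+∣i∣≡-i c
... | inj₁ ∣c∣≡c  = subst (Unit _) ∣c∣≡c (coprime⇒unit-pos coprime)
... | inj₂ ∣c∣≡-c = unit-neg (subst (Unit _) ∣c∣≡-c (coprime⇒unit-pos coprime))

unit-hits-every-residue : .{{NonZero n}} → Unit n c → ∀ y → ∃ λ j → + j * c ≋ y [mod n ]
unit-hits-every-residue {n = n} {c = c} (v , vc≋1) y = (v * y) %ℕ n , (begin
  + ((v * y) %ℕ n) * c   ≈⟨ *-mod-congʳ c ([x%ℕn]≋x (v * y)) ⟩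
  v * y * c              ≡⟨ rearrange v y c ⟩
  v * c * y              ≈⟨ *-mod-congʳ y vc≋1 ⟩
  1ℤ * y                 ≡⟨ ℤP.*-identityˡ y ⟩
  y                      ∎)
  where
  open ModReasoning n
  rearrange : ∀ v y c → v * y * c ≡ v * c * y
  rearrange = solve-∀

x^odd≋1∧x⁴≋1⇒x≋1 : ∀ u → x ^ suc (2 ℕ.* u) ≋ 1ℤ [mod n ] → x ^ 4 ≋ 1ℤ [mod n ] → x ≋ 1ℤ [mod n ]
x^odd≋1∧x⁴≋1⇒x≋1 {x = x} {n = n} u x^odd≋1 x⁴≋1 = begin
  x                        ≡⟨ ℤP.*-identityʳ x ⟨
  x * 1ℤ                   ≈⟨ *-mod-congˡ x (x≋1⇒x^k≋1 u x²≋1) ⟨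
  x * (x ^ 2) ^ u          ≡⟨ cong (x *_) (ℤP.^-*-assoc x 2 u) ⟩
  x ^ suc (2 ℕ.* u)        ≈⟨ x^odd≋1 ⟩
  1ℤ                       ∎
  where
  open ModReasoning n
  x²≋1 : x ^ 2 ≋ 1ℤ [mod n ]
  x²≋1 = begin
    x ^ 2                           ≡⟨ ℤP.*-identityˡ (x ^ 2) ⟨
    1ℤ * x ^ 2                      ≈⟨ *-mod-congʳ (x ^ 2) (x≋1⇒x^k≋1 u x⁴≋1) ⟨
    (x ^ 4) ^ u * x ^ 2             ≡⟨ cong (_* x ^ 2) (ℤP.^-*-assoc x 4 u) ⟩
    x ^ (4 ℕ.* u) * x ^ 2           ≡⟨ ℤP.^-distribˡ-+-* x (4 ℕ.* u) 2 ⟨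
    x ^ (4 ℕ.* u ℕ.+ 2)             ≡⟨ cong (x ^_) (ℕ-arith u) ⟩
    x ^ (suc (2 ℕ.* u) ℕ.* 2)       ≡⟨ ℤP.^-*-assoc x (suc (2 ℕ.* u)) 2 ⟨
    (x ^ suc (2 ℕ.* u)) ^ 2         ≈⟨ x≋1⇒x^k≋1 2 x^odd≋1 ⟩
    1ℤ                              ∎
    where
    ℕ-arith : ∀ u → 4 ℕ.* u ℕ.+ 2 ≡ suc (2 ℕ.* u) ℕ.* 2
    ℕ-arith = ℕSolver.solve-∀

-- Horadam sequences and powers of σ

w-shift : ∀ a b q r k → w a b q (r ℕ.+ k) ≡ w (w a b q k) (w a b q (suc k)) q r
w-shift a b q zero          k = ≡.refl
w-shift a b q (suc zero)    k = ≡.refl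
w-shift a b q (suc (suc r)) k = ≡.cong₂ (λ u v → q * u + v) (w-shift a b q (suc r) k) (w-shift a b q r k)

w-mod-cong : ∀ {a a′ b b′} q → a ≋ a′ [mod n ] → b ≋ b′ [mod n ] → ∀ r → w a b q r ≋ w a′ b′ q r [mod n ]
w-mod-cong q a≋a′ b≋b′ zero          = a≋a′
w-mod-cong q a≋a′ b≋b′ (suc zero)    = b≋b′
w-mod-cong q a≋a′ b≋b′ (suc (suc r)) =
  +-mod-cong (*-mod-congˡ q (w-mod-cong q a≋a′ b≋b′ (suc r))) (w-mod-cong q a≋a′ b≋b′ r)

w-linear : ∀ a b q r → w a b q r ≡ a * w 1ℤ 0ℤ q r + b * w 0ℤ 1ℤ q r
w-linear a b q zero          = first a b
  where
  first : ∀ a b → a ≡ a * 1ℤ + b * 0ℤ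
  first = solve-∀
w-linear a b q (suc zero)    = second a b
  where
  second : ∀ a b → b ≡ a * 0ℤ + b * 1ℤ
  second = solve-∀
w-linear a b q (suc (suc r)) =
  ≡.trans (≡.cong₂ (λ u v → q * u + v) (w-linear a b q (suc r)) (w-linear a b q r))
          (recurrence a b q (w 1ℤ 0ℤ q (suc r)) (w 0ℤ 1ℤ q (suc r)) (w 1ℤ 0ℤ q r) (w 0ℤ 1ℤ q r))
  where
  recurrence : ∀ a b q g₁ f₁ g₀ f₀ →
    q * (a * g₁ + b * f₁) + (a * g₀ + b * f₀) ≡ a * (q * g₁ + g₀) + b * (q * f₁ + f₀)
  recurrence = solve-∀

mat-cong : ∀ {a a′ b b′ c c′ d d′} → a ≡ a′ → b ≡ b′ → c ≡ c′ → d ≡ d′ → mat a b c d ≡ mat a′ b′ c′ d′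
mat-cong ≡.refl ≡.refl ≡.refl ≡.refl = ≡.refl

σ⊗ : ∀ q x y z u → σ q ⊗ mat x y z u ≡ mat (q * x + z) (q * y + u) x y
σ⊗ q x y z u = mat-cong (top q x z) (top q y u) (bottom x z) (bottom y u)
  where
  top : ∀ q x z → q * x + 1ℤ * z ≡ q * x + z
  top = solve-∀
  bottom : ∀ x z → 1ℤ * x + 0ℤ * z ≡ x
  bottom = solve-∀

σ-pow : ∀ q k → σ q ^ᴹ k ≡ mat (w 0ℤ 1ℤ q (suc k)) (w 1ℤ 0ℤ q (suc k)) (w 0ℤ 1ℤ q k) (w 1ℤ 0ℤ q k)
σ-pow q zero    = ≡.refl
σ-pow q (suc k) = ≡.trans (cong (σ q ⊗_) (σ-pow q k)) (σ⊗ q _ _ _ _)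

w-mod-determined : ∀ {a b q i j} →
  w 1ℤ 0ℤ q i ≋ w 1ℤ 0ℤ q j [mod n ] → w 0ℤ 1ℤ q i ≋ w 0ℤ 1ℤ q j [mod n ] →
  w a b q i ≋ w a b q j [mod n ]
w-mod-determined {n = n} {a} {b} {q} {i} {j} g f = begin
  w a b q i                              ≡⟨ w-linear a b q i ⟩
  a * w 1ℤ 0ℤ q i + b * w 0ℤ 1ℤ q i      ≈⟨ +-mod-cong (*-mod-congˡ a g) (*-mod-congˡ b f) ⟩
  a * w 1ℤ 0ℤ q j + b * w 0ℤ 1ℤ q j      ≡⟨ w-linear a b q j ⟨
  w a b q j                              ∎
  where open ModReasoning n

Period : ℤ → ℕ → ℕ → Set
Period q n k = ∀ a b r → w a b q (r ℕ.+ k) ≋ w a b q r [mod n ]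

σ^k≡I⇒period : ∀ {q k} → σ q ^ᴹ k ≡ᴹ I₂ [mod n ] → Period q n k
σ^k≡I⇒period {n = n} {q} {k} σ^k≡I a b r
  with subst (_≡ᴹ I₂ [mod n ]) (σ-pow q k) σ^k≡I
... | f[k+1]≡1 , g[k+1]≡0 , f[k]≡0 , g[k]≡1 =
  subst (_≋ w a b q r [mod n ]) (≡.sym (w-shift a b q r k))
    (w-mod-cong q (w-mod-determined {i = k} {j = 0} (mod g[k]≡1) (mod f[k]≡0))
                  (w-mod-determined {i = suc k} {j = 1} (mod g[k+1]≡0) (mod f[k+1]≡1)) r)

period⇒σ^k≡I : ∀ {q k} → Period q n k → σ q ^ᴹ k ≡ᴹ I₂ [mod n ]
period⇒σ^k≡I {n = n} {q} {k} period = subst (_≡ᴹ I₂ [mod n ]) (≡.sym (σ-pow q k))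
  (unmod (period 0ℤ 1ℤ 1) , unmod (period 1ℤ 0ℤ 1) , unmod (period 0ℤ 1ℤ 0) , unmod (period 1ℤ 0ℤ 0))

period-multiple : ∀ {q k} → Period q n k → ∀ j → Period q n (k ℕ.* j)
period-multiple {n = n} {q} {k} period zero a b r =
  mod-reflexive (cong (w a b q) (≡.trans (cong (r ℕ.+_) (ℕP.*-zeroʳ k)) (ℕP.+-identityʳ r)))
period-multiple {n = n} {q} {k} period (suc j) a b r = begin
  w a b q (r ℕ.+ k ℕ.* suc j)          ≡⟨ cong (w a b q) reassociate ⟩
  w a b q ((r ℕ.+ k) ℕ.+ k ℕ.* j)      ≈⟨ period-multiple period j a b (r ℕ.+ k) ⟩
  w a b q (r ℕ.+ k)                    ≈⟨ period a b r ⟩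
  w a b q r                            ∎
  where
  open ModReasoning n
  reassociate : r ℕ.+ k ℕ.* suc j ≡ (r ℕ.+ k) ℕ.+ k ℕ.* j
  reassociate = ≡.trans (cong (r ℕ.+_) (ℕP.*-suc k j)) (≡.sym (ℕP.+-assoc r k (k ℕ.* j)))

-- Existence of the order of σ modulo n

Minimal : (ℕ → Set) → ℕ → Set
Minimal P k = P k × (∀ j → P j → k ℕ.≤ j)

minimal-witness : ∀ {P : ℕ → Set} → Decidable P → ∀ {n} → P n → ∃ (Minimal P)
minimal-witness {P} P? {n} Pn with search (suc n)
  where
  search : ∀ n → ∃ (Minimal P) ⊎ (∀ j → j ℕ.< n → ¬ P j)
  search zero = inj₂ (λ _ ())
  search (suc n) with search n | P? n
  ... | inj₁ minimal | _      = inj₁ minimal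
  ... | inj₂ none    | yes Pn = inj₁ (n , Pn , λ j Pj → ℕP.≮⇒≥ (λ j<n → none j j<n Pj))
  ... | inj₂ none    | no ¬Pn = inj₂ λ j j<1+n → [ none j , (λ { ≡.refl → ¬Pn }) ]′ (ℕP.m<1+n⇒m<n∨m≡n j<1+n)
... | inj₁ minimal = minimal
... | inj₂ none    = contradiction Pn (none n ℕP.≤-refl)

residue : ∀ n .{{_ : NonZero n}} → ℤ → Fin n
residue n x = fromℕ< (n%ℕd<d x n)

residue-injective : ∀ .{{_ : NonZero n}} x y → residue n x ≡ residue n y → x ≋ y [mod n ]
residue-injective {n = n} x y eq = begin
  x               ≈⟨ [x%ℕn]≋x x ⟨
  + (x %ℕ n)      ≡⟨ cong +_ (FP.fromℕ<-injective _ _ (n%ℕd<d x n) (n%ℕd<d y n) eq) ⟩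
  + (y %ℕ n)      ≈⟨ [x%ℕn]≋x y ⟩
  y               ∎
  where open ModReasoning n

residueᴹ : ∀ n .{{_ : NonZero n}} → Mat2 → Fin ((n ℕ.* n) ℕ.* (n ℕ.* n))
residueᴹ n (mat a b c d) = combine (combine (residue n a) (residue n b)) (combine (residue n c) (residue n d))

residueᴹ-injective : ∀ .{{_ : NonZero n}} A B → residueᴹ n A ≡ residueᴹ n B → A ≡ᴹ B [mod n ]
residueᴹ-injective {n = n} (mat a b c d) (mat a′ b′ c′ d′) eq
  with FP.combine-injective _ _ _ _ eq
... | top , bottom
  with FP.combine-injective _ _ _ _ top | FP.combine-injective _ _ _ _ bottom
... | a~a′ , b~b′ | c~c′ , d~d′ =
  unmod (residue-injective a a′ a~a′) , unmod (residue-injective b b′ b~b′) ,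
  unmod (residue-injective c c′ c~c′) , unmod (residue-injective d d′ d~d′)

⊗-congˡ : ∀ C A B → A ≡ᴹ B [mod n ] → C ⊗ A ≡ᴹ C ⊗ B [mod n ]
⊗-congˡ (mat c₁₁ c₁₂ c₂₁ c₂₂) (mat _ _ _ _) (mat _ _ _ _) (e₁₁ , e₁₂ , e₂₁ , e₂₂) =
  row c₁₁ c₁₂ e₁₁ e₂₁ , row c₁₁ c₁₂ e₁₂ e₂₂ , row c₂₁ c₂₂ e₁₁ e₂₁ , row c₂₁ c₂₂ e₁₂ e₂₂
  where
  row : ∀ c c′ {x x′ y y′} → x ≡ y [mod _ ] → x′ ≡ y′ [mod _ ] → c * x + c′ * x′ ≡ c * y + c′ * y′ [mod _ ]
  row c c′ e e′ = unmod (+-mod-cong (*-mod-congˡ c (mod e)) (*-mod-congˡ c′ (mod e′)))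

≡ᴹ-sym : ∀ A B → A ≡ᴹ B [mod n ] → B ≡ᴹ A [mod n ]
≡ᴹ-sym (mat a b c d) (mat a′ b′ c′ d′) (e₁₁ , e₁₂ , e₂₁ , e₂₂) =
  flip a a′ e₁₁ , flip b b′ e₁₂ , flip c c′ e₂₁ , flip d d′ e₂₂
  where
  flip : ∀ x y → x ≡ y [mod _ ] → y ≡ x [mod _ ]
  flip x y e = unmod (mod-sym (mod {x} {y} e))

σ⁻¹ : ℤ → Mat2
σ⁻¹ q = mat 0ℤ 1ℤ 1ℤ (- q)

σ⁻¹⊗σ⊗ : ∀ q A → σ⁻¹ q ⊗ (σ q ⊗ A) ≡ A
σ⁻¹⊗σ⊗ q (mat x y z u) =
  ≡.trans (cong (σ⁻¹ q ⊗_) (σ⊗ q x y z u)) (mat-cong (top q x z) (top q y u) (bottom q x z) (bottom q y u))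
  where
  top : ∀ q x z → 0ℤ * (q * x + z) + 1ℤ * x ≡ x
  top = solve-∀
  bottom : ∀ q x z → 1ℤ * (q * x + z) + - q * x ≡ z
  bottom = solve-∀

σ-pow-cancel : ∀ q i d → σ q ^ᴹ i ≡ᴹ σ q ^ᴹ (i ℕ.+ d) [mod n ] → I₂ ≡ᴹ σ q ^ᴹ d [mod n ]
σ-pow-cancel q zero    d eq = eq
σ-pow-cancel {n = n} q (suc i) d eq = σ-pow-cancel q i d
  (≡.subst₂ (_≡ᴹ_[mod n ]) (σ⁻¹⊗σ⊗ q (σ q ^ᴹ i)) (σ⁻¹⊗σ⊗ q (σ q ^ᴹ (i ℕ.+ d)))
    (⊗-congˡ (σ⁻¹ q) (σ q ^ᴹ suc i) (σ q ^ᴹ suc (i ℕ.+ d)) eq))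

≡-mod? : ∀ n x y → Dec (x ≡ y [mod n ])
≡-mod? n x y = n ND.∣? ∣ x - y ∣

≡ᴹ-mod? : ∀ n A B → Dec (A ≡ᴹ B [mod n ])
≡ᴹ-mod? n A B = ≡-mod? n (m11 A) (m11 B) ×-dec ≡-mod? n (m12 A) (m12 B) ×-dec
                ≡-mod? n (m21 A) (m21 B) ×-dec ≡-mod? n (m22 A) (m22 B)

σ-finite-order : ∀ q n → 0 < n → ∃ λ d → 0 < d × σ q ^ᴹ d ≡ᴹ I₂ [mod n ]
σ-finite-order q n@(suc _) _ with FP.pigeonhole (ℕP.n<1+n _) (λ i → residueᴹ n (σ q ^ᴹ toℕ i))
... | i , j , i<j , same-residue =
  e , ℕP.m<n⇒0<n∸m i<j , ≡ᴹ-sym I₂ (σ q ^ᴹ e) (σ-pow-cancel q (toℕ i) e σ^i≡σ^[i+e])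
  where
  e = toℕ j ∸ toℕ i
  σ^i≡σ^[i+e] : σ q ^ᴹ toℕ i ≡ᴹ σ q ^ᴹ (toℕ i ℕ.+ e) [mod n ]
  σ^i≡σ^[i+e] = subst (λ l → σ q ^ᴹ toℕ i ≡ᴹ σ q ^ᴹ l [mod n ]) (≡.sym (ℕP.m+[n∸m]≡n (ℕP.<⇒≤ i<j)))
    (residueᴹ-injective (σ q ^ᴹ toℕ i) (σ q ^ᴹ toℕ j) same-residue)

order-exists : ∀ q n → 0 < n → ∃ (IsOrder q n)
order-exists q n 0<n with σ-finite-order q n 0<n
... | d , 0<d , σ^d≡I
  with minimal-witness (λ j → (0 ℕ.<? j) ×-dec ≡ᴹ-mod? n (σ q ^ᴹ j) I₂) (0<d , σ^d≡I)
... | k , (0<k , σ^k≡I) , minimal = k , 0<k , σ^k≡I , λ j 0<j σ^j≡I → minimal j (0<j , σ^j≡I)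

-- Moduli at which σ has a double eigenvalue t

module DoubleRoot {n : ℕ} {q t : ℤ} (q≋2t : q ≋ t + t [mod n ]) (t²+1≋0 : t * t + 1ℤ ≋ 0ℤ [mod n ]) where

  open ModReasoning n

  t²≋-1 : t * t ≋ - 1ℤ [mod n ]
  t²≋-1 = begin
    t * t                 ≡⟨ solve (t ∷ []) ⟩
    (t * t + 1ℤ) - 1ℤ     ≈⟨ +-mod-congʳ (- 1ℤ) t²+1≋0 ⟩
    - 1ℤ                  ∎

  t-unit : Unit n t
  t-unit = - t , (begin
    - t * t               ≡⟨ solve (t ∷ []) ⟩
    - (t * t)             ≈⟨ -‿mod-cong t²≋-1 ⟩
    1ℤ                    ∎)

  t⁴≋1 : t ^ 4 ≋ 1ℤ [mod n ]
  t⁴≋1 = begin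
    t ^ 4                 ≡⟨ square-square t ⟩
    (t * t) * (t * t)     ≈⟨ *-mod-cong t²≋-1 t²≋-1 ⟩
    1ℤ                    ∎
    where
    square-square : ∀ t → t * (t * (t * (t * 1ℤ))) ≡ (t * t) * (t * t)
    square-square = solve-∀

  gap-geometric : ∀ a b r → w a b q (suc r) - t * w a b q r ≋ t ^ r * (b - t * a) [mod n ]
  gap-geometric a b zero    = mod-reflexive (≡.sym (ℤP.*-identityˡ (b - t * a)))
  gap-geometric a b (suc r) = begin
    q * W₁ + W₀ - t * W₁                     ≈⟨ +-mod-congʳ (- (t * W₁)) (+-mod-congʳ W₀ (*-mod-congʳ W₁ q≋2t)) ⟩
    (t + t) * W₁ + W₀ - t * W₁               ≡⟨ regroup t W₁ W₀ ⟩
    t * (W₁ - t * W₀) + (t * t + 1ℤ) * W₀    ≈⟨ +-mod-cong (*-mod-congˡ t (gap-geometric a b r)) (*-mod-congʳ W₀ t²+1≋0) ⟩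
    t * (t ^ r * (b - t * a)) + 0ℤ * W₀      ≡⟨ drop (t * (t ^ r * (b - t * a))) W₀ ⟩
    t * (t ^ r * (b - t * a))                ≡⟨ ℤP.*-assoc t (t ^ r) (b - t * a) ⟨
    t ^ suc r * (b - t * a)                  ∎
    where
    W₁ = w a b q (suc r)
    W₀ = w a b q r
    regroup : ∀ t W₁ W₀ → (t + t) * W₁ + W₀ - t * W₁ ≡ t * (W₁ - t * W₀) + (t * t + 1ℤ) * W₀
    regroup = solve-∀
    drop : ∀ x y → x + 0ℤ * y ≡ x
    drop = solve-∀

  closed-form : ∀ a b r → t * w a b q r ≋ t ^ r * (t * a + + r * (b - t * a)) [mod n ]
  closed-form a b zero    = mod-reflexive (base t a (b - t * a))
    where
    base : ∀ t a d → t * a ≡ 1ℤ * (t * a + 0ℤ * d)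
    base = solve-∀
  closed-form a b (suc r) = begin
    t * W₁                                         ≡⟨ split t W₁ W₀ ⟩
    t * (W₁ - t * W₀) + t * (t * W₀)               ≈⟨ +-mod-cong (*-mod-congˡ t (gap-geometric a b r)) (*-mod-congˡ t (closed-form a b r)) ⟩
    t * (T * δ) + t * (T * (t * a + R * δ))        ≡⟨ collect t T a δ R ⟩
    t * T * (t * a + (1ℤ + R) * δ)                 ∎
    where
    W₁ = w a b q (suc r)
    W₀ = w a b q r
    T = t ^ r
    δ = b - t * a
    R = + r
    split : ∀ t W₁ W₀ → t * W₁ ≡ t * (W₁ - t * W₀) + t * (t * W₀)
    split = solve-∀
    collect : ∀ t T a δ R → t * (T * δ) + t * (T * (t * a + R * δ)) ≡ t * T * (t * a + (1ℤ + R) * δ)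
    collect = solve-∀

  shift-by-vanishing : ∀ {K} a b r → + K ≋ 0ℤ [mod n ] → t * w a b q (r ℕ.+ K) ≋ t ^ K * (t * w a b q r) [mod n ]
  shift-by-vanishing {K} a b r K≋0 = begin
    t * w a b q (r ℕ.+ K)                         ≈⟨ closed-form a b (r ℕ.+ K) ⟩
    t ^ (r ℕ.+ K) * (t * a + + (r ℕ.+ K) * δ)     ≡⟨ ≡.cong₂ (λ T R → T * (t * a + R * δ)) (ℤP.^-distribˡ-+-* t r K) (ℤP.pos-+ r K) ⟩
    t ^ r * t ^ K * (t * a + (+ r + + K) * δ)     ≈⟨ *-mod-congˡ (t ^ r * t ^ K)
                                                      (+-mod-congˡ (t * a) (*-mod-congʳ δ (+-mod-congˡ (+ r) K≋0))) ⟩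
    t ^ r * t ^ K * (t * a + (+ r + 0ℤ) * δ)      ≡⟨ rearrange (t ^ r) (t ^ K) (t * a) (+ r) δ ⟩
    t ^ K * (t ^ r * (t * a + + r * δ))           ≈⟨ *-mod-congˡ (t ^ K) (closed-form a b r) ⟨
    t ^ K * (t * w a b q r)                       ∎
    where
    δ = b - t * a
    rearrange : ∀ T T′ A R δ → T * T′ * (A + (R + 0ℤ) * δ) ≡ T′ * (T * (A + R * δ))
    rearrange = solve-∀

  shift-by-multiple : ∀ {k} a b r j → t ^ k ≋ 1ℤ [mod n ] →
    t * w a b q (r ℕ.+ k ℕ.* j) ≋ t * w a b q r + + j * (+ k * (t ^ r * (b - t * a))) [mod n ]
  shift-by-multiple {k} a b r j t^k≋1 = begin
    t * w a b q (r ℕ.+ k ℕ.* j)                              ≈⟨ closed-form a b (r ℕ.+ k ℕ.* j) ⟩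
    t ^ (r ℕ.+ k ℕ.* j) * (t * a + + (r ℕ.+ k ℕ.* j) * δ)    ≡⟨ ≡.cong₂ (λ T R → T * (t * a + R * δ)) exponent index ⟩
    t ^ r * (t ^ k) ^ j * (t * a + (+ r + + k * + j) * δ)    ≈⟨ *-mod-congʳ (t * a + (+ r + + k * + j) * δ)
                                                                  (*-mod-congˡ (t ^ r) (x≋1⇒x^k≋1 j t^k≋1)) ⟩
    t ^ r * 1ℤ * (t * a + (+ r + + k * + j) * δ)             ≡⟨ rearrange (t ^ r) (t * a) (+ r) (+ k) (+ j) δ ⟩
    t ^ r * (t * a + + r * δ) + + j * (+ k * (t ^ r * δ))    ≈⟨ +-mod-congʳ (+ j * (+ k * (t ^ r * δ))) (closed-form a b r) ⟨
    t * w a b q r + + j * (+ k * (t ^ r * δ))                ∎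
    where
    δ = b - t * a
    exponent : t ^ (r ℕ.+ k ℕ.* j) ≡ t ^ r * (t ^ k) ^ j
    exponent = ≡.trans (ℤP.^-distribˡ-+-* t r (k ℕ.* j)) (cong (t ^ r *_) (≡.sym (ℤP.^-*-assoc t k j)))
    index : + (r ℕ.+ k ℕ.* j) ≡ + r + + k * + j
    index = ≡.trans (ℤP.pos-+ r (k ℕ.* j)) (cong (λ z → + r + z) (ℤP.pos-* k j))
    rearrange : ∀ T A R K J δ → T * 1ℤ * (A + (R + K * J) * δ) ≡ T * (A + R * δ) + J * (K * (T * δ))
    rearrange = solve-∀

  σ^k≡I⇔t^k≡1 : ∀ {k} → + k ≋ 0ℤ [mod n ] → σ q ^ᴹ k ≡ᴹ I₂ [mod n ] ⇔ t ^ k ≋ 1ℤ [mod n ]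
  σ^k≡I⇔t^k≡1 {k} k≋0 = mk⇔ to from
    where
    to : σ q ^ᴹ k ≡ᴹ I₂ [mod n ] → t ^ k ≋ 1ℤ [mod n ]
    to σ^k≡I = mod-sym (unit-cancelˡ t-unit (begin
      t * 1ℤ                   ≈⟨ *-mod-congˡ t (σ^k≡I⇒period {q = q} {k = k} σ^k≡I 0ℤ 1ℤ 1) ⟨
      t * w 0ℤ 1ℤ q (suc k)    ≈⟨ shift-by-vanishing 0ℤ 1ℤ 1 k≋0 ⟩
      t ^ k * (t * 1ℤ)         ≡⟨ commute (t ^ k) t ⟩
      t * t ^ k                ∎))
      where
      commute : ∀ T t → T * (t * 1ℤ) ≡ t * T
      commute = solve-∀
    from : t ^ k ≋ 1ℤ [mod n ] → σ q ^ᴹ k ≡ᴹ I₂ [mod n ]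
    from t^k≋1 = period⇒σ^k≡I λ a b r → unit-cancelˡ t-unit (begin
      t * w a b q (r ℕ.+ k)      ≈⟨ shift-by-vanishing a b r k≋0 ⟩
      t ^ k * (t * w a b q r)    ≈⟨ *-mod-congʳ (t * w a b q r) t^k≋1 ⟩
      1ℤ * (t * w a b q r)       ≡⟨ ℤP.*-identityˡ (t * w a b q r) ⟩
      t * w a b q r              ∎)

  hits-every-residue : ∀ {k} .{{_ : NonZero n}} → t ^ k ≋ 1ℤ [mod n ] → Unit n (+ k) →
    ∀ {a b} → Unit n (b - t * a) → ∀ r x → ∃ λ j → w a b q (r ℕ.+ k ℕ.* j) ≋ x [mod n ]
  hits-every-residue {k} t^k≋1 k-unit {a} {b} δ-unit r x = j , unit-cancelˡ t-unit (begin
    t * w a b q (r ℕ.+ k ℕ.* j)     ≈⟨ shift-by-multiple {k = k} a b r j t^k≋1 ⟩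
    t * W + + j * γ                 ≈⟨ +-mod-congˡ (t * W) jc≋tx-tW ⟩
    t * W + (t * x - t * W)         ≡⟨ cancel (t * W) (t * x) ⟩
    t * x                           ∎)
    where
    W = w a b q r
    γ = + k * (t ^ r * (b - t * a))
    hit = unit-hits-every-residue (unit-* k-unit (unit-* (unit-^ t-unit r) δ-unit)) (t * x - t * W)
    j = proj₁ hit
    jc≋tx-tW : + j * γ ≋ t * x - t * W [mod n ]
    jc≋tx-tW = proj₂ hit
    cancel : ∀ y z → y + (z - y) ≡ z
    cancel = solve-∀

  discriminant≋-square : ∀ a b → a * a + q * a * b - b * b ≋ - ((b - t * a) * (b - t * a)) [mod n ]
  discriminant≋-square a b = begin
    a * a + q * a * b - b * b         ≈⟨ +-mod-congʳ (- (b * b)) (+-mod-congˡ (a * a) (*-mod-congʳ b (*-mod-congʳ a q≋2t))) ⟩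
    a * a + (t + t) * a * b - b * b   ≡⟨ regroup t a b ⟩
    (t * t + 1ℤ) * (a * a) - δ * δ    ≈⟨ +-mod-congʳ (- (δ * δ)) (*-mod-congʳ (a * a) t²+1≋0) ⟩
    0ℤ * (a * a) - δ * δ              ≡⟨ drop (a * a) (δ * δ) ⟩
    - (δ * δ)                         ∎
    where
    δ = b - t * a
    regroup : ∀ t a b → a * a + (t + t) * a * b - b * b ≡ (t * t + 1ℤ) * (a * a) - (b - t * a) * (b - t * a)
    regroup = solve-∀
    drop : ∀ x y → 0ℤ * x - y ≡ - y
    drop = solve-∀

  discriminant-unit⇒gap-unit : ∀ a b → Unit n (a * a + q * a * b - b * b) → Unit n (b - t * a)
  discriminant-unit⇒gap-unit a b unit = unit-factorʳ {c = - (b - t * a)}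
    (subst (Unit n) (ℤP.neg-distribˡ-* (b - t * a) (b - t * a)) (unit-resp (discriminant≋-square a b) unit))

  σ^nk≡I⇒t^k≡1 : ∀ {k u} → n ≡ suc (2 ℕ.* u) → σ q ^ᴹ (n ℕ.* k) ≡ᴹ I₂ [mod n ] → t ^ k ≋ 1ℤ [mod n ]
  σ^nk≡I⇒t^k≡1 {k} {u} n≡1+2u σ^nk≡I = x^odd≋1∧x⁴≋1⇒x≋1 u
    (subst (λ e → (t ^ k) ^ e ≋ 1ℤ [mod n ]) n≡1+2u (begin
      (t ^ k) ^ n      ≡⟨ ℤP.^-*-assoc t k n ⟩
      t ^ (k ℕ.* n)    ≡⟨ cong (t ^_) (ℕP.*-comm k n) ⟩
      t ^ (n ℕ.* k)    ≈⟨ Equivalence.to (σ^k≡I⇔t^k≡1 nk≋0) σ^nk≡I ⟩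
      1ℤ               ∎))
    (begin
      (t ^ k) ^ 4      ≡⟨ ℤP.^-*-assoc t k 4 ⟩
      t ^ (k ℕ.* 4)    ≡⟨ cong (t ^_) (ℕP.*-comm k 4) ⟩
      t ^ (4 ℕ.* k)    ≡⟨ ℤP.^-*-assoc t 4 k ⟨
      (t ^ 4) ^ k      ≈⟨ x≋1⇒x^k≋1 k t⁴≋1 ⟩
      1ℤ               ∎)
    where
    nk≋0 : + (n ℕ.* k) ≋ 0ℤ [mod n ]
    nk≋0 = [a+m*n]≡b⇒b≋a {a = 0} {m = k} (ℕP.*-comm k n)

-- Lifting from m to p m

coprime-∣⇒*∣ : ∀ {p m z} → gcd p m ≡ 1 → p ND.∣ z → m ND.∣ z → p ℕ.* m ND.∣ z
coprime-∣⇒*∣ {p} {m} gcd≡1 p∣z m∣z = subst (ND._∣ _) lcm≡p*m (lcm-least p∣z m∣z)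
  where
  lcm≡p*m : lcm p m ≡ p ℕ.* m
  lcm≡p*m = begin
    lcm p m                ≡⟨ ℕP.*-identityˡ (lcm p m) ⟨
    1 ℕ.* lcm p m          ≡⟨ cong (ℕ._* lcm p m) gcd≡1 ⟨
    gcd p m ℕ.* lcm p m    ≡⟨ gcd*lcm p m ⟩
    p ℕ.* m                ∎
    where open ≡.≡-Reasoning

≡ᴹ-crt : ∀ {p m} A B → gcd p m ≡ 1 → A ≡ᴹ B [mod p ] → A ≡ᴹ B [mod m ] → A ≡ᴹ B [mod p ℕ.* m ]
≡ᴹ-crt _ _ gcd≡1 (a₁₁ , a₁₂ , a₂₁ , a₂₂) (b₁₁ , b₁₂ , b₂₁ , b₂₂) =
  coprime-∣⇒*∣ gcd≡1 a₁₁ b₁₁ , coprime-∣⇒*∣ gcd≡1 a₁₂ b₁₂ , coprime-∣⇒*∣ gcd≡1 a₂₁ b₂₁ , coprime-∣⇒*∣ gcd≡1 a₂₂ b₂₂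

≡ᴹ-weaken : ∀ {p} m A B → A ≡ᴹ B [mod p ℕ.* m ] → A ≡ᴹ B [mod p ]
≡ᴹ-weaken {p} m _ _ (e₁₁ , e₁₂ , e₂₁ , e₂₂) = weaken e₁₁ , weaken e₁₂ , weaken e₂₁ , weaken e₂₂
  where
  weaken : ∀ {z} → p ℕ.* m ND.∣ z → p ND.∣ z
  weaken = ND.∣-trans (ND.m∣m*n m)

order-lift⇒σ^k≢I : ∀ {q p m k} → 1 < p → gcd p m ≡ 1 →
  IsOrder q m k → IsOrder q (p ℕ.* m) (p ℕ.* k) → ¬ σ q ^ᴹ k ≡ᴹ I₂ [mod p ]
order-lift⇒σ^k≢I {q} {p} {k = k} 1<p gcd≡1 (0<k , σ^k≡I[m] , _) (_ , _ , minimal) σ^k≡I[p] =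
  ℕP.<⇒≱ k<p*k (minimal k 0<k (≡ᴹ-crt (σ q ^ᴹ k) I₂ gcd≡1 σ^k≡I[p] σ^k≡I[m]))
  where
  k<p*k : k < p ℕ.* k
  k<p*k = subst (k <_) (ℕP.*-comm k p) (ℕP.m<m*n k p {{ℕ.>-nonZero 0<k}} 1<p)

prime-∤⇒coprime : ∀ {p k} → Prime p → ¬ p ND.∣ k → Coprime p k
prime-∤⇒coprime p-prime p∤k (d∣p , d∣k) with prime⇒irreducible p-prime d∣p
... | inj₁ d≡1   = d≡1
... | inj₂ ≡.refl = contradiction d∣k p∤k

order-lift⇒t^k≋1∧unit-k : ∀ {q t p m k u} → Prime p → p ≡ suc (2 ℕ.* u) → gcd p m ≡ 1 →
  q ≋ t + t [mod p ] → t * t + 1ℤ ≋ 0ℤ [mod p ] →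
  IsOrder q m k → IsOrder q (p ℕ.* m) (p ℕ.* k) → t ^ k ≋ 1ℤ [mod p ] × Unit p (+ k)
order-lift⇒t^k≋1∧unit-k {q} {t} {p} {m} {k} {u} p-prime p≡1+2u gcd≡1 q≋2t t²+1≋0 k-order pk-order =
  t^k≋1 , coprime⇒unit (prime-∤⇒coprime p-prime p∤k)
  where
  open DoubleRoot {q = q} {t = t} q≋2t t²+1≋0
  t^k≋1 : t ^ k ≋ 1ℤ [mod p ]
  t^k≋1 = σ^nk≡I⇒t^k≡1 {u = u} p≡1+2u (≡ᴹ-weaken m (σ q ^ᴹ (p ℕ.* k)) I₂ (proj₁ (proj₂ pk-order)))
  p∤k : ¬ p ND.∣ k
  p∤k (ND.divides i k≡i*p) =
    order-lift⇒σ^k≢I (ℕ.nonTrivial⇒n>1 p {{prime⇒nonTrivial p-prime}}) gcd≡1 k-order pk-order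
      (Equivalence.from (σ^k≡I⇔t^k≡1 ([a+m*n]≡b⇒b≋a {a = 0} {m = i} (≡.sym k≡i*p))) t^k≋1)

-- Odd primes dividing q² + 4

odd-prime : ∀ {p} → Prime p → p ≢ 2 → ∃ λ u → p ≡ suc (2 ℕ.* u)
odd-prime {p} p-prime p≢2 with p % 2 | m%n<n p 2 | m≡m%n+[m/n]*n p 2
... | 0 | _ | p≡[p/2]*2 with prime⇒irreducible p-prime (ND.divides (p / 2) p≡[p/2]*2)
...   | inj₁ ()
...   | inj₂ 2≡p = contradiction (≡.sym 2≡p) p≢2
odd-prime {p} p-prime p≢2 | 1 | _ | p≡1+[p/2]*2 = p / 2 , ≡.trans p≡1+[p/2]*2 (cong suc (ℕP.*-comm (p / 2) 2))
odd-prime {p} p-prime p≢2 | suc (suc _) | s≤s (s≤s ()) | _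

double-root : ∀ {p u q} → p ≡ suc (2 ℕ.* u) → (+ p) ∣ (q * q + + 4) →
  let t = q * + suc u in q ≋ t + t [mod p ] × t * t + 1ℤ ≋ 0ℤ [mod p ]
double-root {p} {u} {q} p≡1+2u p∣q²+4 = q≋2t , t²+1≋0
  where
  open ModReasoning p
  h = + suc u
  P = + p
  2h≡1+p : + 2 * h ≡ 1ℤ + P
  2h≡1+p = ≡.trans (≡.sym (ℤP.pos-* 2 (suc u)))
                   (cong +_ (≡.trans (ℕP.*-suc 2 u) (cong suc (≡.sym p≡1+2u))))
  q≋2t : q ≋ q * h + q * h [mod p ]
  q≋2t = mod-sym (begin
    q * h + q * h          ≡⟨ double q h ⟩
    q * (+ 2 * h)          ≡⟨ cong (q *_) 2h≡1+p ⟩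
    q * (1ℤ + P)           ≡⟨ ℤP.*-distribˡ-+ q 1ℤ P ⟩
    q * 1ℤ + q * P         ≡⟨ cong (_+ q * P) (ℤP.*-identityʳ q) ⟩
    q + q * P              ≈⟨ [x+y*n]≋x q q ⟩
    q                      ∎)
    where
    double : ∀ q h → q * h + q * h ≡ q * (+ 2 * h)
    double = solve-∀
  t²+1≋0 : q * h * (q * h) + 1ℤ ≋ 0ℤ [mod p ]
  t²+1≋0 = begin
    q * h * (q * h) + 1ℤ                                  ≡⟨ expand q h ⟩
    h * h * (q * q + + 4) + (1ℤ - (+ 2 * h) * (+ 2 * h))  ≡⟨ cong (λ z → h * h * (q * q + + 4) + (1ℤ - z * z)) 2h≡1+p ⟩
    h * h * (q * q + + 4) + (1ℤ - (1ℤ + P) * (1ℤ + P))    ≡⟨ cong (λ z → h * h * (q * q + + 4) + z) (square P) ⟩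
    h * h * (q * q + + 4) + (0ℤ + (- (P + + 2)) * P)      ≈⟨ +-mod-cong (*-mod-congˡ (h * h) q²+4≋0) ([x+y*n]≋x 0ℤ (- (P + + 2))) ⟩
    h * h * 0ℤ + 0ℤ                                       ≡⟨ vanish (h * h) ⟩
    0ℤ                                                    ∎
    where
    q²+4≋0 : q * q + + 4 ≋ 0ℤ [mod p ]
    q²+4≋0 = mod (subst ((+ p) ∣_) (≡.sym (ℤP.+-identityʳ (q * q + + 4))) p∣q²+4)
    expand : ∀ q h → q * h * (q * h) + 1ℤ ≡ h * h * (q * q + + 4) + (1ℤ - (+ 2 * h) * (+ 2 * h))
    expand = solve-∀
    square : ∀ P → 1ℤ - (1ℤ + P) * (1ℤ + P) ≡ 0ℤ + (- (P + + 2)) * P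
    square = solve-∀
    vanish : ∀ y → y * 0ℤ + 0ℤ ≡ 0ℤ
    vanish = solve-∀

lemma3p2 : (a b q : ℤ) → q ≢ + 0 →
    (p m : ℕ) → Prime p → p ≢ 2 → (+ p) ∣ (q * q + + 4) →
    0 < m → gcd p m ≡ 1 →
    gcd ∣ a * a + q * a * b - b * b ∣ p ≡ 1 →
    (∀ k₁ k₂ → IsOrder q (p Data.Nat.* m) k₁ → IsOrder q m k₂ → k₁ ≡ p Data.Nat.* k₂) →
    ResidueComplete (w a b q) m →
    ResidueComplete (w a b q) (p Data.Nat.* m)
lemma3p2 a b q _ p m p-prime p≢2 p∣q²+4 0<m gcd[p,m]≡1 gcd[X,p]≡1 k[pm]≡p·k[m] complete x =
  r ℕ.+ k ℕ.* j , coprime-∣⇒*∣ gcd[p,m]≡1 (unmod w≋x[mod-p]) (unmod w≋x[mod-m])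
  where
  instance
    p≢0 : NonZero p
    p≢0 = prime⇒nonZero p-prime
  u = proj₁ (odd-prime p-prime p≢2)
  p≡1+2u = proj₂ (odd-prime p-prime p≢2)
  t = q * + suc u
  roots = double-root {u = u} {q = q} p≡1+2u p∣q²+4
  open DoubleRoot {q = q} {t = t} (proj₁ roots) (proj₂ roots)

  k = proj₁ (order-exists q m 0<m)
  k-order = proj₂ (order-exists q m 0<m)
  pk-order : IsOrder q (p ℕ.* m) (p ℕ.* k)
  pk-order with order-exists q (p ℕ.* m) (ℕ.>-nonZero⁻¹ (p ℕ.* m) {{ℕP.m*n≢0 p m {{p≢0}} {{ℕ.>-nonZero 0<m}}}})
  ... | K , K-order = subst (IsOrder q (p ℕ.* m)) (k[pm]≡p·k[m] K k K-order k-order) K-order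
  conditions = order-lift⇒t^k≋1∧unit-k {u = u} p-prime p≡1+2u gcd[p,m]≡1 (proj₁ roots) (proj₂ roots) k-order pk-order
  gap-unit = discriminant-unit⇒gap-unit a b (coprime⇒unit (Cop.sym (gcd≡1⇒coprime gcd[X,p]≡1)))

  r = proj₁ (complete x)
  hit = hits-every-residue (proj₁ conditions) (proj₂ conditions) gap-unit r x
  j = proj₁ hit
  w≋x[mod-p] = proj₂ hit
  w≋x[mod-m] : w a b q (r ℕ.+ k ℕ.* j) ≋ x [mod m ]
  w≋x[mod-m] = mod-trans (period-multiple (σ^k≡I⇒period {q = q} {k = k} (proj₁ (proj₂ k-order))) j a b r)
                         (mod (proj₂ (complete x)))
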